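{- For every integer $n\ge 1$, there is a bijection between the set of isomorphism classes of unbalanced bipartite posets on $n$ points and the set of isomorphism classes of bipartite posets on $t$ points, where $t$ ranges over $0\le t\le n-1$.
   Context: A bipartite poset is a finite poset of height at most one (no three elements $x\prec y\prec z$); here the empty poset is allowed (for $t=0$). An element $v$ has height 1 if there is $u$ with $u\prec v$, and height 0 otherwise. A height-0 element is a full support point if it is comparable to every height-1 element. A bipartite poset is unbalanced if it contains a full support point and balanced otherwise. Posets are considered up to isomorphism. -}

module Defs where

open import Data.Nat using (ℕ; _≤_; _<_)
open import Data.Fin using (Fin; toℕ)
open import Data.Bool using (Bool; T)
open import Data.Product using (Σ; ∃; _×_; _,_; proj₁; proj₂)
open import Data.Sum using (_⊎_)
open import Relation.Nullary using (¬_)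
open import Data.Empty using (⊥)
open import Relation.Binary.PropositionalEquality
  using (_≡_; refl; sym; trans; cong₂)
open import Relation.Binary.Bundles using (Setoid)
open import Relation.Binary.Structures using (IsEquivalence)
open import Function.Bundles using (_↔_; Inverse; Bijection)
open import Function.Properties.Inverse using (↔-refl; ↔-sym; ↔-trans)
open import Level using (0ℓ)

-- A bipartite poset on the point set Fin n, given by its strict order
-- relation _≺_ (as a decidable, Bool-valued relation): a strict partial
-- order (irreflexive, transitive) of height at most one, i.e. with no
-- chain x ≺ y ≺ z.
record BipPoset (n : ℕ) : Set where
  field
    rel     : Fin n → Fin n → Bool
    irrefl  : ∀ x → ¬ T (rel x x)
    transit : ∀ x y z → T (rel x y) → T (rel y z) → T (rel x z)
    height  : ∀ x y z → T (rel x y) → T (rel y z) → ⊥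
open BipPoset public

_≺[_]_ : ∀ {n} → Fin n → BipPoset n → Fin n → Set
x ≺[ P ] y = T (rel P x y)

Height1 : ∀ {n} → BipPoset n → Fin n → Set
Height1 P v = ∃ λ u → u ≺[ P ] v

Height0 : ∀ {n} → BipPoset n → Fin n → Set
Height0 P v = ¬ Height1 P v

Comparable : ∀ {n} → BipPoset n → Fin n → Fin n → Set
Comparable P x y = x ≡ y ⊎ (x ≺[ P ] y ⊎ y ≺[ P ] x)

FullSupport : ∀ {n} → BipPoset n → Fin n → Set
FullSupport P x = Height0 P x × (∀ v → Height1 P v → Comparable P x v)

Unbalanced : ∀ {n} → BipPoset n → Set
Unbalanced P = ∃ λ x → FullSupport P x

-- Poset isomorphism (possibly between point sets of different sizes;
-- an isomorphism forces the sizes to agree).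
Iso : ∀ {m k} → BipPoset m → BipPoset k → Set
Iso {m} {k} P Q = Σ (Fin m ↔ Fin k) λ f →
  ∀ x y → rel P x y ≡ rel Q (Inverse.to f x) (Inverse.to f y)

Iso-refl : ∀ {m} (P : BipPoset m) → Iso P P
Iso-refl P = ↔-refl , λ x y → refl

Iso-sym : ∀ {m k} {P : BipPoset m} {Q : BipPoset k} → Iso P Q → Iso Q P
Iso-sym {P = P} {Q} (f , p) = ↔-sym f , λ x y →
  sym (trans (p (Inverse.from f x) (Inverse.from f y))
             (cong₂ (rel Q) (Inverse.strictlyInverseˡ f x) (Inverse.strictlyInverseˡ f y)))

Iso-trans : ∀ {m k l} {P : BipPoset m} {Q : BipPoset k} {R : BipPoset l} →
            Iso P Q → Iso Q R → Iso P R
Iso-trans (f , p) (g , q) = ↔-trans f g , λ x y → trans (p x y) (q _ _)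

UnbalancedSetoid : ℕ → Setoid 0ℓ 0ℓ
UnbalancedSetoid n = record
  { Carrier = Σ (BipPoset n) Unbalanced
  ; _≈_ = λ A B → Iso (proj₁ A) (proj₁ B)
  ; isEquivalence = record
      { refl = λ {A} → Iso-refl (proj₁ A)
      ; sym = λ {A} {B} → Iso-sym {P = proj₁ A} {proj₁ B}
      ; trans = λ {A} {B} {C} → Iso-trans {P = proj₁ A} {proj₁ B} {proj₁ C} } }

-- Bipartite posets on t points for some 0 ≤ t ≤ n-1 (i.e. t : Fin n),
-- up to isomorphism (disjoint union over t of the iso classes).
SmallerSetoid : ℕ → Setoid 0ℓ 0ℓ
SmallerSetoid n = record
  { Carrier = Σ (Fin n) (λ t → BipPoset (toℕ t))
  ; _≈_ = λ A B → Iso (proj₂ A) (proj₂ B)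
  ; isEquivalence = record
      { refl = λ {A} → Iso-refl (proj₂ A)
      ; sym = λ {A} {B} → Iso-sym {P = proj₂ A} {proj₂ B}
      ; trans = λ {A} {B} {C} → Iso-trans {P = proj₂ A} {proj₂ B} {proj₂ C} } }

module Submission where

open import Defs
open import Data.Nat using (ℕ; _≤_)
open import Function.Bundles using (Bijection)

open import Data.Nat using (suc; _+_; _∸_; _<_)
open import Data.Nat.Properties using (+-cancelʳ-≡; m∸n+n≡m; <⇒≤; m<n+m; m<n⇒0<n; m<n⇒0<n∸m)
open import Data.Fin using (Fin; toℕ; fromℕ<)
import Data.Fin as F
open import Data.Fin.Properties using (any?; all?; ¬∀⟶∃¬; +↔⊎; toℕ<n; toℕ-fromℕ<)
open import Data.Fin.Permutation using (↔⇒≡)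
open import Data.Bool using (Bool; true; false; not; _∧_; T)
open import Data.Bool.Properties using (not-involutive; T-∧; T-not-≡)
open import Data.Unit using (tt)
open import Data.Empty using (⊥; ⊥-elim)
open import Data.Product using (Σ; ∃; ∃₂; _×_; _,_; proj₁; proj₂)
open import Data.Sum using (_⊎_; inj₁; inj₂; swap)
open import Data.Sum.Algebra using (⊎-cong; ⊎-comm; ⊎-assoc)
open import Data.Sum.Properties using (inj₂-injective)
open import Function using (_∘_; flip)
open import Function.Bundles using (_↔_; Inverse; Injection; Equivalence; mk⇔; mk↔ₛ′)
open import Function.Properties.Inverse using (↔-refl; ↔-sym; ↔-trans; ↔⇒↣)
open import Level using (0ℓ)
open import Relation.Nullary using (¬_; Dec; isYes; isNo)
open import Relation.Nullary.Decidable
  using (T?; ¬?; _×-dec_; _⊎-dec_; _→-dec_; does-⇔; toWitness; fromWitness;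
         toWitnessFalse; fromWitnessFalse; decidable-stable)
open import Relation.Unary using (Decidable)
open import Relation.Binary.PropositionalEquality
  using (_≡_; refl; sym; trans; cong; cong₂; subst; module ≡-Reasoning)

open Inverse using (to; from)
  renaming (strictlyInverseˡ to to∘from; strictlyInverseʳ to from∘to)

-- In an unbalanced P, the k ≥ 1 full support points have height 0 and lie
-- below every height-1 point, so P is determined by k and by the t = n - k other
-- points.  On these we record the bipartite complement of P: i ≺' j iff i has
-- height 0, j has height 1 and i ⊀ j (the forward map).  Conversely, from Q on t
-- points and k ≥ 1 support points we rebuild a poset on Fin k ⊎ Fin t: points of
-- Q lying below something ("lower") get height 0, maximal ones get height 1, the
-- support lies below every maximal point, and inside Q we complement again (the
-- reconstruction).  Complementing inside a fixed rectangle L × H is an involution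
-- (complementIn-involutive), which makes both round trips isomorphisms.

T-ext : ∀ {a b} → (T a → T b) → (T b → T a) → a ≡ b
T-ext a⇒b b⇒a = does-⇔ (mk⇔ a⇒b b⇒a) (T? _) (T? _)

complement-twice : ∀ a r → (T r → T a) → a ∧ not (a ∧ not r) ≡ r
complement-twice true  r     _   = not-involutive r
complement-twice false false _   = refl
complement-twice false true  r⇒a = ⊥-elim (r⇒a tt)

isLeft : {A B : Set} → A ⊎ B → Bool
isLeft (inj₁ _) = true
isLeft (inj₂ _) = false

fromLeft : {A B : Set} (w : A ⊎ B) → T (isLeft w) → A
fromLeft (inj₁ a) _ = a

fromRight : {A B : Set} (w : A ⊎ B) → isLeft w ≡ false → B
fromRight (inj₂ b) _ = b

fromRight-eq : {A B : Set} (w : A ⊎ B) (r : isLeft w ≡ false) → w ≡ inj₂ (fromRight w r)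
fromRight-eq (inj₂ b) _ = refl

-- Heights, comparability and full support for a Boolean relation on any carrier;
-- for R = rel P they are, definitionally, Height1 P, Comparable P and FullSupport P.
module _ {A : Set} (R : A → A → Bool) where
  Height1ᴿ : A → Set
  Height1ᴿ v = ∃ λ u → T (R u v)

  Comparableᴿ : A → A → Set
  Comparableᴿ x y = x ≡ y ⊎ (T (R x y) ⊎ T (R y x))

  FullSupportᴿ : A → Set
  FullSupportᴿ x = ¬ Height1ᴿ x × (∀ v → Height1ᴿ v → Comparableᴿ x v)

-- A bijection of carriers transporting one relation onto the other; Iso P Q is
-- definitionally RelIso (rel P) (rel Q).
RelIso : {A B : Set} → (A → A → Bool) → (B → B → Bool) → Set
RelIso {A} {B} R S = Σ (A ↔ B) λ f → ∀ x y → R x y ≡ S (to f x) (to f y)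

RelIso-sym : ∀ {A B} {R : A → A → Bool} {S : B → B → Bool} → RelIso R S → RelIso S R
RelIso-sym {R = R} {S} (f , pres) = ↔-sym f , λ x y →
  sym (trans (pres (from f x) (from f y)) (cong₂ S (to∘from f x) (to∘from f y)))

RelIso-trans : ∀ {A B C} {R : A → A → Bool} {S : B → B → Bool} {U : C → C → Bool} →
               RelIso R S → RelIso S U → RelIso R U
RelIso-trans (f , p) (g , q) = ↔-trans f g , λ x y → trans (p x y) (q _ _)

module Invariance {A B : Set} (R : A → A → Bool) (S : B → B → Bool) (I : RelIso R S) where
  private
    f : A ↔ B
    f = proj₁ I

    pres : ∀ x y → R x y ≡ S (to f x) (to f y)
    pres = proj₂ I

    pres⁻¹ : ∀ x y → S x y ≡ R (from f x) (from f y)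
    pres⁻¹ = proj₂ (RelIso-sym {R = R} {S = S} I)

  height1-preserved : ∀ {x} → Height1ᴿ R x → Height1ᴿ S (to f x)
  height1-preserved {x} (u , u≺x) = to f u , subst T (pres u x) u≺x

  height1-reflected : ∀ {x} → Height1ᴿ S (to f x) → Height1ᴿ R x
  height1-reflected {x} (w , w≺fx) =
    from f w , subst T (trans (pres⁻¹ w (to f x)) (cong (R (from f w)) (from∘to f x))) w≺fx

  comparable-preserved : ∀ {x y} → Comparableᴿ R x y → Comparableᴿ S (to f x) (to f y)
  comparable-preserved (inj₁ x≡y)               = inj₁ (cong (to f) x≡y)
  comparable-preserved {x} {y} (inj₂ (inj₁ x≺y)) = inj₂ (inj₁ (subst T (pres x y) x≺y))
  comparable-preserved {x} {y} (inj₂ (inj₂ y≺x)) = inj₂ (inj₂ (subst T (pres y x) y≺x))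

  comparable-reflected : ∀ {x y} → Comparableᴿ S (to f x) (to f y) → Comparableᴿ R x y
  comparable-reflected (inj₁ fx≡fy)              = inj₁ (Injection.injective (↔⇒↣ f) fx≡fy)
  comparable-reflected {x} {y} (inj₂ (inj₁ x≺y)) = inj₂ (inj₁ (subst T (sym (pres x y)) x≺y))
  comparable-reflected {x} {y} (inj₂ (inj₂ y≺x)) = inj₂ (inj₂ (subst T (sym (pres y x)) y≺x))

  fullSupport-preserved : ∀ {x} → FullSupportᴿ R x → FullSupportᴿ S (to f x)
  fullSupport-preserved (height0 , below-all) =
    (λ h → height0 (height1-reflected h)) , λ w h →
      subst (Comparableᴿ S _) (to∘from f w)
        (comparable-preserved (below-all (from f w)
          (height1-reflected (subst (Height1ᴿ S) (sym (to∘from f w)) h))))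

  fullSupport-reflected : ∀ {x} → FullSupportᴿ S (to f x) → FullSupportᴿ R x
  fullSupport-reflected (height0 , below-all) =
    (λ h → height0 (height1-preserved h)) , λ v h →
      comparable-reflected (below-all (to f v) (height1-preserved h))

module _ {A : Set} (L H : A → Bool) where
  Disjoint : Set
  Disjoint = ∀ x → T (L x) → T (H x) → ⊥

  Inside : (A → A → Bool) → Set
  Inside R = ∀ x y → T (R x y) → T (L x) × T (H y)

  complementIn : (A → A → Bool) → A → A → Bool
  complementIn R x y = (L x ∧ H y) ∧ not (R x y)

  complementIn-inside : ∀ R → Inside (complementIn R)
  complementIn-inside R x y c = Equivalence.to T-∧ (proj₁ (Equivalence.to T-∧ c))

  complementIn-excludes : ∀ R {x y} → T (complementIn R x y) → ¬ T (R x y)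
  complementIn-excludes R c r =
    subst T (Equivalence.to T-not-≡ (proj₂ (Equivalence.to T-∧ c))) r

  complementIn-intro : ∀ R {x y} → T (L x) → T (H y) → ¬ T (R x y) → T (complementIn R x y)
  complementIn-intro R {x} {y} l h ¬r with R x y
  ... | true  = ⊥-elim (¬r tt)
  ... | false = Equivalence.from T-∧ (Equivalence.from T-∧ (l , h) , tt)

  complementIn-involutive : ∀ {R} → Inside R → ∀ x y → complementIn (complementIn R) x y ≡ R x y
  complementIn-involutive {R} inside x y = complement-twice (L x ∧ H y) (R x y)
    (λ r → Equivalence.from T-∧ (inside x y r))

inside-height1 : ∀ {A} {L H : A → Bool} {R} → Inside L H R → ∀ {y} → Height1ᴿ R y → T (H y)
inside-height1 inside (u , u≺y) = proj₂ (inside _ _ u≺y)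

-- A relation inside a rectangle with disjoint sides has no chains x ≺ y ≺ z, so
-- pulled back along any map from Fin n it is a bipartite poset.
rectanglePoset : ∀ {A n} {L H : A → Bool} {R : A → A → Bool} →
                 Disjoint L H → Inside L H R → (Fin n → A) → BipPoset n
rectanglePoset {R = R} disjoint inside f = record
  { rel     = λ x y → R (f x) (f y)
  ; irrefl  = λ x r → disjoint (f x) (proj₁ (inside _ _ r)) (proj₂ (inside _ _ r))
  ; transit = λ x y z r s → ⊥-elim (noChain x y z r s)
  ; height  = noChain }
  where
  noChain : ∀ x y z → T (R (f x) (f y)) → T (R (f y) (f z)) → ⊥
  noChain x y z r s = disjoint (f y) (proj₁ (inside _ _ s)) (proj₂ (inside _ _ r))

module _ {n} (P : BipPoset n) where
  height1? : Decidable (Height1 P)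
  height1? v = any? (λ u → T? (rel P u v))

  high low : Fin n → Bool
  high v = isYes (height1? v)
  low  v = isNo (height1? v)

  high⇒height1 : ∀ {v} → T (high v) → Height1 P v
  high⇒height1 {v} = toWitness {a? = height1? v}

  height1⇒high : ∀ {v} → Height1 P v → T (high v)
  height1⇒high {v} = fromWitness {a? = height1? v}

  low⇒height0 : ∀ {v} → T (low v) → Height0 P v
  low⇒height0 {v} = toWitnessFalse {a? = height1? v}

  height0⇒low : ∀ {v} → Height0 P v → T (low v)
  height0⇒low {v} = fromWitnessFalse {a? = height1? v}

  low-high-disjoint : Disjoint low high
  low-high-disjoint x l h = low⇒height0 l (high⇒height1 h)

  rel-inside : Inside low high (rel P)
  rel-inside x y x≺y = height0⇒low (λ (u , u≺x) → height P u x y u≺x x≺y) , height1⇒high (x , x≺y)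

  comparable? : ∀ x v → Dec (Comparable P x v)
  comparable? x v = (x F.≟ v) ⊎-dec (T? (rel P x v) ⊎-dec T? (rel P v x))

  fullSupport? : Decidable (FullSupport P)
  fullSupport? x = ¬? (height1? x) ×-dec all? (λ v → height1? v →-dec comparable? x v)

  isFullSupport : Fin n → Bool
  isFullSupport x = isYes (fullSupport? x)

  isFullSupport⇒ : ∀ {x} → T (isFullSupport x) → FullSupport P x
  isFullSupport⇒ {x} = toWitness {a? = fullSupport? x}

  ⇒isFullSupport : ∀ {x} → FullSupport P x → T (isFullSupport x)
  ⇒isFullSupport {x} = fromWitness {a? = fullSupport? x}

  fullSupport-minimal : ∀ {y} → FullSupport P y → ∀ x → rel P x y ≡ false
  fullSupport-minimal fs x = T-ext (λ x≺y → proj₁ fs (x , x≺y)) λ ()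

  fullSupport-below : ∀ {x} → FullSupport P x → ∀ y → rel P x y ≡ high y
  fullSupport-below {x} (height0 , below-all) y = T-ext (λ x≺y → height1⇒high (x , x≺y)) edge
    where
    edge : T (high y) → x ≺[ P ] y
    edge h with below-all y (high⇒height1 h)
    ... | inj₁ refl       = ⊥-elim (height0 (high⇒height1 h))
    ... | inj₂ (inj₁ x≺y) = x≺y
    ... | inj₂ (inj₂ y≺x) = ⊥-elim (height0 (y , y≺x))

  misses-high : ∀ {x} → Height0 P x → ¬ FullSupport P x → ∃ λ v → Height1 P v × ¬ x ≺[ P ] v
  -- Some v falsifies "v has height 1 ⇒ x, v comparable"; then v has height 1
  -- (otherwise the implication holds vacuously) and x ⊀ v.
  misses-high {x} height0 ¬fs
    with ¬∀⟶∃¬ n _ (λ v → height1? v →-dec comparable? x v) (λ all → ¬fs (height0 , all))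
  ... | v , ¬edge = v , decidable-stable (height1? v) (λ ¬h → ¬edge (λ h → ⊥-elim (¬h h))) ,
                    λ x≺v → ¬edge (λ _ → inj₂ (inj₁ x≺v))

record Split {n} (s : Fin n → Bool) (k t : ℕ) : Set where
  field
    φ     : Fin n ↔ (Fin k ⊎ Fin t)
    sorts : ∀ x → isLeft (to φ x) ≡ s x

module _ {n} {s : Fin n → Bool} where
  split-size : ∀ {k t} → Split s k t → n ≡ k + t
  split-size sp = ↔⇒≡ (↔-trans (Split.φ sp) (↔-sym +↔⊎))

  swap-split : ∀ {k t} → Split (not ∘ s) k t → Split s t k
  swap-split record { φ = φ ; sorts = sorts } = record
    { φ     = ↔-trans φ (⊎-comm _ _)
    ; sorts = λ x → trans (isLeft-swap (to φ x))
                          (trans (cong not (sorts x)) (not-involutive (s x))) }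
    where
    isLeft-swap : ∀ {A B : Set} (w : A ⊎ B) → isLeft (swap w) ≡ not (isLeft w)
    isLeft-swap (inj₁ _) = refl
    isLeft-swap (inj₂ _) = refl

cons-split : ∀ {n k t} {s : Fin (suc n) → Bool} →
             s F.zero ≡ true → Split (s ∘ F.suc) k t → Split s (suc k) t
cons-split {n} {k} {t} {s} s0 record { φ = φ ; sorts = sorts } =
  record { φ = φ′ ; sorts = sorts′ }
  where
  -- Fin (1 + n) ↔ Fin 1 ⊎ (Fin k ⊎ Fin t) ↔ (Fin 1 ⊎ Fin k) ⊎ Fin t ↔ Fin (1 + k) ⊎ Fin t
  φ′ : Fin (suc n) ↔ (Fin (suc k) ⊎ Fin t)
  φ′ = ↔-trans (+↔⊎ {1} {n}) (↔-trans (⊎-cong ↔-refl φ)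
         (↔-trans (↔-sym (⊎-assoc 0ℓ _ _ _)) (⊎-cong (↔-sym (+↔⊎ {1} {k})) ↔-refl)))
  sorts′ : ∀ x → isLeft (to φ′ x) ≡ s x
  sorts′ F.zero = sym s0
  sorts′ (F.suc x) with to φ x | sorts x
  ... | inj₁ _ | e = e
  ... | inj₂ _ | e = e

-- Every Boolean predicate on Fin n splits Fin n (induction on n; a point 0
-- failing s is put in front of the left side for the negated predicate).
split : ∀ {n} (s : Fin n → Bool) → ∃₂ λ k t → Split s k t
split {0} s = 0 , 0 , record { φ = +↔⊎ ; sorts = λ () }
split {suc n} s with s F.zero in s0
... | true  = let (k , t , sp) = split (s ∘ F.suc) in suc k , t , cons-split s0 sp
... | false = let (k , t , sp) = split (not ∘ s ∘ F.suc) in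
              t , suc k , swap-split (cons-split (cong not s0) sp)

-- Given a splitting φ of P along its full support points, the
-- points ψ j = φ⁻¹ (inj₂ j) are the others, and they carry the bipartite
-- complement of P: i ≺ j iff ψ i has height 0, ψ j has height 1 and ψ i ⊀ ψ j.
forward : ∀ {n k t} (P : BipPoset n) → Split (isFullSupport P) k t → BipPoset t
forward P sp = rectanglePoset (low-high-disjoint P) (complementIn-inside (low P) (high P) (rel P))
                              (λ j → from (Split.φ sp) (inj₂ j))

-- A bipartite poset Q on t points and k support points give
-- a relation on Fin k ⊎ Fin t: lower points of Q (those below something) form the
-- bottom layer together with the support, maximal points of Q the top layer; the
-- support lies below every maximal point and inside Q we take the complement.
module _ {t} (Q : BipPoset t) where
  below? : ∀ j → Dec (∃ λ l → j ≺[ Q ] l)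
  below? j = any? (λ l → T? (rel Q j l))

  below maximal : Fin t → Bool
  below   j = isYes (below? j)
  maximal j = isNo (below? j)

  below⇒edge : ∀ {j} → T (below j) → ∃ λ l → j ≺[ Q ] l
  below⇒edge {j} = toWitness {a? = below? j}

  edge⇒below : ∀ {j} → (∃ λ l → j ≺[ Q ] l) → T (below j)
  edge⇒below {j} = fromWitness {a? = below? j}

  maximal⇒no-edge : ∀ {j} → T (maximal j) → ¬ ∃ λ l → j ≺[ Q ] l
  maximal⇒no-edge {j} = toWitnessFalse {a? = below? j}

  no-edge⇒maximal : ∀ {j} → ¬ (∃ λ l → j ≺[ Q ] l) → T (maximal j)
  no-edge⇒maximal {j} = fromWitnessFalse {a? = below? j}

  Q-inside : Inside below maximal (rel Q)
  Q-inside j l j≺l = edge⇒below (l , j≺l) , no-edge⇒maximal (λ (m , l≺m) → height Q j l m j≺l l≺m)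

  module _ {k : ℕ} where
    lowerˣ upperˣ : Fin k ⊎ Fin t → Bool
    lowerˣ (inj₁ _) = true
    lowerˣ (inj₂ j) = below j
    upperˣ (inj₁ _) = false
    upperˣ (inj₂ j) = maximal j

    extendRel : Fin k ⊎ Fin t → Fin k ⊎ Fin t → Bool
    extendRel (inj₁ _) (inj₁ _) = false
    extendRel (inj₁ _) (inj₂ j) = maximal j
    extendRel (inj₂ _) (inj₁ _) = false
    extendRel (inj₂ i) (inj₂ j) = complementIn below maximal (rel Q) i j

    extend-disjoint : Disjoint lowerˣ upperˣ
    extend-disjoint (inj₂ j) b m = maximal⇒no-edge m (below⇒edge b)

    extend-inside : Inside lowerˣ upperˣ extendRel
    extend-inside (inj₁ _) (inj₂ j) m = tt , m
    extend-inside (inj₂ i) (inj₂ j) c = complementIn-inside below maximal (rel Q) i j c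

    reconstruct : ∀ {n} → Fin n ↔ (Fin k ⊎ Fin t) → BipPoset n
    reconstruct θ = rectanglePoset extend-disjoint extend-inside (to θ)

    -- With at least one support point a₀, the height-1 points are the upper ones
    -- and the full support points are exactly the support points.
    module _ (a₀ : Fin k) where
      upper⇒height1 : ∀ w → T (upperˣ w) → Height1ᴿ extendRel w
      upper⇒height1 (inj₂ j) m = inj₁ a₀ , m

      support⇒fullSupport : ∀ w → T (isLeft w) → FullSupportᴿ extendRel w
      support⇒fullSupport (inj₁ a) _ = inside-height1 extend-inside , λ
        { (inj₁ b) h → ⊥-elim (inside-height1 extend-inside h)
        ; (inj₂ j) h → inj₂ (inj₁ (inside-height1 extend-inside h)) }

      -- A point j of Q is not full support: being of height 0 it is not maximal
      -- (it would lie above a₀), so j ≺ l in Q for some l.  Then l is maximal,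
      -- hence of height 1, but j and l are incomparable: the complement omits
      -- the edge j ≺ l, and l ≺ j would make l a lower point.
      fullSupport⇒support : ∀ w → FullSupportᴿ extendRel w → T (isLeft w)
      fullSupport⇒support (inj₁ _) _ = tt
      fullSupport⇒support (inj₂ j) (height0 , below-all)
        with decidable-stable (below? j)
               (λ ¬edge → height0 (upper⇒height1 (inj₂ j) (no-edge⇒maximal ¬edge)))
      ... | l , j≺l
        with below-all (inj₂ l) (upper⇒height1 (inj₂ l) (proj₂ (Q-inside j l j≺l)))
      ... | inj₁ refl        = irrefl Q j j≺l
      ... | inj₂ (inj₁ j≺ᶜl) = complementIn-excludes below maximal (rel Q) j≺ᶜl j≺l
      ... | inj₂ (inj₂ l≺ᶜj) = maximal⇒no-edge (proj₂ (Q-inside j l j≺l))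
          (below⇒edge (proj₁ (complementIn-inside below maximal (rel Q) l j l≺ᶜj)))

module Sorted {n k t} (P : BipPoset n) (sp : Split (isFullSupport P) k t) where
  open Split sp public

  ψ : Fin t → Fin n
  ψ j = from φ (inj₂ j)

  left⇒fullSupport : ∀ {x a} → to φ x ≡ inj₁ a → FullSupport P x
  left⇒fullSupport {x} e = isFullSupport⇒ P (subst T (trans (cong isLeft (sym e)) (sorts x)) tt)

  right⇒ψ : ∀ {x j} → to φ x ≡ inj₂ j → ψ j ≡ x
  right⇒ψ {x} e = trans (cong (from φ) (sym e)) (from∘to φ x)

  ψ-not-fullSupport : ∀ j → ¬ FullSupport P (ψ j)
  ψ-not-fullSupport j fs =
    subst T (trans (sym (sorts (ψ j))) (cong isLeft (to∘from φ (inj₂ j)))) (⇒isFullSupport P fs)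

  not-fullSupport⇒ψ : ∀ {x} → ¬ FullSupport P x → ∃ λ j → ψ j ≡ x
  not-fullSupport⇒ψ {x} ¬fs with to φ x in e
  ... | inj₁ _ = ⊥-elim (¬fs (left⇒fullSupport e))
  ... | inj₂ j = j , right⇒ψ e

module _ {n k t} (P : BipPoset n) (sp : Split (isFullSupport P) k t) where
  open Sorted P sp
  private
    Q : BipPoset t
    Q = forward P sp

  -- The lower points of the forward image are those of height 0 in P: a
  -- height-0 non-full-support point misses some height-1 point, which is not a
  -- full support point either.
  below-forward : ∀ j → below Q j ≡ low P (ψ j)
  below-forward j = T-ext lower⇒low low⇒lower
    where
    lower⇒low : T (below Q j) → T (low P (ψ j))
    lower⇒low b = let (l , c) = below⇒edge Q b in
      proj₁ (complementIn-inside (low P) (high P) (rel P) (ψ j) (ψ l) c)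
    low⇒lower : T (low P (ψ j)) → T (below Q j)
    low⇒lower lo with misses-high P (low⇒height0 P lo) (ψ-not-fullSupport j)
    ... | v , v-high , ¬edge with not-fullSupport⇒ψ (λ fs → proj₁ fs v-high)
    ... | l , refl = edge⇒below Q
          (l , complementIn-intro (low P) (high P) (rel P) lo (height1⇒high P v-high) ¬edge)

  maximal-forward : ∀ j → maximal Q j ≡ high P (ψ j)
  maximal-forward j = trans (cong not (below-forward j)) (not-involutive _)

  forward-reconstructs : RelIso (rel P) (extendRel Q {k})
  forward-reconstructs = φ , λ x y → relate x y (to φ x) (to φ y) refl refl
    where
    open ≡-Reasoning
    relate : ∀ x y w₁ w₂ → to φ x ≡ w₁ → to φ y ≡ w₂ → rel P x y ≡ extendRel Q w₁ w₂
    relate x y (inj₁ _) (inj₁ _) _ ey = fullSupport-minimal P (left⇒fullSupport ey) x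
    relate x y (inj₂ _) (inj₁ _) _ ey = fullSupport-minimal P (left⇒fullSupport ey) x
    relate x y (inj₁ _) (inj₂ j) ex ey = begin
      rel P x y      ≡⟨ fullSupport-below P (left⇒fullSupport ex) y ⟩
      high P y       ≡⟨ cong (high P) (sym (right⇒ψ ey)) ⟩
      high P (ψ j)   ≡⟨ sym (maximal-forward j) ⟩
      maximal Q j    ∎
    relate x y (inj₂ i) (inj₂ j) ex ey = begin
      rel P x y
        ≡⟨ cong₂ (rel P) (sym (right⇒ψ ex)) (sym (right⇒ψ ey)) ⟩
      rel P (ψ i) (ψ j)
        ≡⟨ sym (complementIn-involutive (low P) (high P) (rel-inside P) (ψ i) (ψ j)) ⟩
      (low P (ψ i) ∧ high P (ψ j)) ∧ not (rel Q i j)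
        ≡⟨ cong (λ b → b ∧ not (rel Q i j))
                (sym (cong₂ _∧_ (below-forward i) (maximal-forward j))) ⟩
      (below Q i ∧ maximal Q j) ∧ not (rel Q i j)
        ∎

module Restrict {A B C D : Set} (h : (A ⊎ B) ↔ (C ⊎ D))
                (sides : ∀ w → isLeft (to h w) ≡ isLeft w) where
  private
    sides⁻¹ : ∀ w → isLeft (from h w) ≡ isLeft w
    sides⁻¹ w = trans (sym (sides (from h w))) (cong isLeft (to∘from h w))

    σ : B → D
    σ b = fromRight (to h (inj₂ b)) (sides (inj₂ b))

    τ : D → B
    τ d = fromRight (from h (inj₂ d)) (sides⁻¹ (inj₂ d))

  restrictʳ-spec : ∀ b → to h (inj₂ b) ≡ inj₂ (σ b)
  restrictʳ-spec b = fromRight-eq _ _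

  private
    τ-spec : ∀ d → from h (inj₂ d) ≡ inj₂ (τ d)
    τ-spec d = fromRight-eq _ _

  restrictʳ : B ↔ D
  restrictʳ = mk↔ₛ′ σ τ
    (λ d → inj₂-injective (trans (sym (restrictʳ-spec (τ d)))
                          (trans (cong (to h) (sym (τ-spec d))) (to∘from h (inj₂ d)))))
    (λ b → inj₂-injective (trans (sym (τ-spec (σ b)))
                          (trans (cong (from h) (sym (restrictʳ-spec b))) (from∘to h (inj₂ b)))))

-- The
-- isomorphism matches full support points with support points, hence restricts
-- to the remaining points, where complementing undoes the complement.
module _ {n k k′ t t′} (Q : BipPoset t) (a₀ : Fin k) (P : BipPoset n)
         (I : RelIso (rel P) (extendRel Q {k})) (sp : Split (isFullSupport P) k′ t′) where
  open Sorted P sp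
  open Invariance (rel P) (extendRel Q) I
  private
    f : Fin n ↔ (Fin k ⊎ Fin t)
    f = proj₁ I

    isFullSupport-via : ∀ x → isFullSupport P x ≡ isLeft (to f x)
    isFullSupport-via x = T-ext
      (λ fs → fullSupport⇒support Q a₀ (to f x) (fullSupport-preserved (isFullSupport⇒ P fs)))
      (λ l → ⇒isFullSupport P (fullSupport-reflected (support⇒fullSupport Q a₀ (to f x) l)))

    high-via : ∀ x → high P x ≡ upperˣ Q (to f x)
    high-via x = T-ext
      (λ h → inside-height1 (extend-inside Q) (height1-preserved (high⇒height1 P h)))
      (λ u → height1⇒high P (height1-reflected (upper⇒height1 Q a₀ (to f x) u)))

    h : (Fin k′ ⊎ Fin t′) ↔ (Fin k ⊎ Fin t)
    h = ↔-trans (↔-sym φ) f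

    h-sides : ∀ w → isLeft (to h w) ≡ isLeft w
    h-sides w = begin
      isLeft (to f (from φ w))      ≡⟨ sym (isFullSupport-via (from φ w)) ⟩
      isFullSupport P (from φ w)    ≡⟨ sym (sorts (from φ w)) ⟩
      isLeft (to φ (from φ w))      ≡⟨ cong isLeft (to∘from φ w) ⟩
      isLeft w                      ∎
      where open ≡-Reasoning

    open Restrict h h-sides

    σ : Fin t′ → Fin t
    σ = to restrictʳ

    high-ψ : ∀ j → high P (ψ j) ≡ maximal Q (σ j)
    high-ψ j = trans (high-via (ψ j)) (cong (upperˣ Q) (restrictʳ-spec j))

    low-ψ : ∀ i → low P (ψ i) ≡ below Q (σ i)
    low-ψ i = trans (cong not (high-ψ i)) (not-involutive _)

    rel-ψ : ∀ i j → rel P (ψ i) (ψ j) ≡ extendRel Q {k} (inj₂ (σ i)) (inj₂ (σ j))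
    rel-ψ i j = trans (proj₂ I (ψ i) (ψ j))
                      (cong₂ (extendRel Q {k}) (restrictʳ-spec i) (restrictʳ-spec j))

  reconstruct-forward : Iso (forward P sp) Q
  reconstruct-forward = restrictʳ , λ i j → begin
    (low P (ψ i) ∧ high P (ψ j)) ∧ not (rel P (ψ i) (ψ j))
      ≡⟨ cong₂ (λ a b → a ∧ not b) (cong₂ _∧_ (low-ψ i) (high-ψ j)) (rel-ψ i j) ⟩
    (below Q (σ i) ∧ maximal Q (σ j)) ∧ not (extendRel Q {k} (inj₂ (σ i)) (inj₂ (σ j)))
      ≡⟨ complementIn-involutive (below Q) (maximal Q) (Q-inside Q) (σ i) (σ j) ⟩
    rel Q (σ i) (σ j)
      ∎
    where open ≡-Reasoning

extend-cong : ∀ {k k′ t t′} {Q : BipPoset t} {Q′ : BipPoset t′} →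
              Fin k ↔ Fin k′ → Iso Q Q′ → RelIso (extendRel Q {k}) (extendRel Q′ {k′})
extend-cong {Q = Q} {Q′} e (g , pres) = ⊎-cong e g , pres′
  where
  -- lying below some point means having height 1 in the opposite order
  open Invariance (flip (rel Q)) (flip (rel Q′)) (g , flip pres)
  below-pres : ∀ j → below Q j ≡ below Q′ (to g j)
  below-pres j = T-ext (λ b → edge⇒below Q′ (height1-preserved (below⇒edge Q b)))
                       (λ b → edge⇒below Q (height1-reflected (below⇒edge Q′ b)))
  pres′ : ∀ w₁ w₂ → extendRel Q w₁ w₂ ≡ extendRel Q′ (to (⊎-cong e g) w₁) (to (⊎-cong e g) w₂)
  pres′ (inj₁ _) (inj₁ _) = refl
  pres′ (inj₁ _) (inj₂ j) = cong not (below-pres j)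
  pres′ (inj₂ _) (inj₁ _) = refl
  pres′ (inj₂ i) (inj₂ j) =
    cong₂ (λ a b → a ∧ not b) (cong₂ _∧_ (below-pres i) (cong not (below-pres j))) (pres i j)

-- An unbalanced poset split along its full support points: k ≥ 1 support points
-- (witnessed by `support`) and rest < n remaining points.
record Presentation {n} (P : BipPoset n) : Set where
  field
    rest    : Fin n
    k       : ℕ
    support : Fin k
    sp      : Split (isFullSupport P) k (toℕ rest)

present : ∀ {n} (P : BipPoset n) → Unbalanced P → Presentation P
present {n} P (x , x-fs) = build (split (isFullSupport P))
  where
  build : (∃₂ λ k t → Split (isFullSupport P) k t) → Presentation P
  build (k , t , sp) = record
    { rest = fromℕ< t<n ; k = k ; support = a
    ; sp = subst (Split (isFullSupport P) k) (sym (toℕ-fromℕ< t<n)) sp }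
    where
    a : Fin k
    a = fromLeft (to (Split.φ sp) x) (subst T (sym (Split.sorts sp x)) (⇒isFullSupport P x-fs))
    t<n : t < n
    t<n = subst (t <_) (sym (split-size sp)) (m<n+m t (m<n⇒0<n (toℕ<n a)))

-- The forward map on unbalanced posets, and the three properties making it a
-- bijection of setoids.  (Composites of RelIso name their middle relations,
-- which Agda cannot infer through the Σ-type of RelIso.)
module _ (n : ℕ) where
  UnbalancedPoset SmallerPoset : Set
  UnbalancedPoset = Σ (BipPoset n) Unbalanced
  SmallerPoset    = Σ (Fin n) (λ t → BipPoset (toℕ t))

  forwardClass : UnbalancedPoset → SmallerPoset
  forwardClass (P , u) = rest , forward P sp
    where open Presentation (present P u)

  forward-cong : ∀ {A B : UnbalancedPoset} →
                 Iso (proj₁ A) (proj₁ B) → Iso (proj₂ (forwardClass A)) (proj₂ (forwardClass B))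
  forward-cong {P , u} {P′ , u′} P≅P′ =
    reconstruct-forward Q′ support′ P
      (RelIso-trans {S = rel P′} {U = extendRel Q′} P≅P′ (forward-reconstructs P′ sp′)) sp
    where
    open Presentation (present P u)
    open Presentation (present P′ u′)
      renaming (sp to sp′; support to support′; rest to rest′) using ()
    Q′ : BipPoset (toℕ rest′)
    Q′ = forward P′ sp′

  -- Isomorphic forward images have the same size, hence supports of the same
  -- size, and so isomorphic reconstructions.
  forward-injective : ∀ {A B : UnbalancedPoset} →
                      Iso (proj₂ (forwardClass A)) (proj₂ (forwardClass B)) → Iso (proj₁ A) (proj₁ B)
  forward-injective {P , u} {P′ , u′} Q≅Q′ =
    RelIso-trans {S = extendRel Q {k}} {U = rel P′} (forward-reconstructs P sp)
      (RelIso-trans {S = extendRel Q′ {k′}} {U = rel P′} (extend-cong k↔k′ Q≅Q′)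
                    (RelIso-sym {R = rel P′} (forward-reconstructs P′ sp′)))
    where
    open Presentation (present P u)
    open Presentation (present P′ u′) renaming (sp to sp′; k to k′; rest to rest′) using ()
    Q : BipPoset (toℕ rest)
    Q = forward P sp
    Q′ : BipPoset (toℕ rest′)
    Q′ = forward P′ sp′
    k≡k′ : k ≡ k′
    k≡k′ = +-cancelʳ-≡ (toℕ rest) k k′ (begin
      k + toℕ rest    ≡⟨ sym (split-size sp) ⟩
      n               ≡⟨ split-size sp′ ⟩
      k′ + toℕ rest′  ≡⟨ cong (k′ +_) (sym (↔⇒≡ (proj₁ Q≅Q′))) ⟩
      k′ + toℕ rest   ∎)
      where open ≡-Reasoning
    k↔k′ : Fin k ↔ Fin k′
    k↔k′ = subst (λ m → Fin k ↔ Fin m) k≡k′ ↔-refl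

  -- Q on t < n points is the forward image of its reconstruction with n - t ≥ 1
  -- support points, and of everything isomorphic to it.
  forward-surjective : ∀ (B : SmallerPoset) → ∃ λ (A : UnbalancedPoset) →
                       ∀ {Z : UnbalancedPoset} → Iso (proj₁ Z) (proj₁ A) →
                       Iso (proj₂ (forwardClass Z)) (proj₂ B)
  forward-surjective (rest , Q) = (P₀ , P₀-unbalanced) , λ {(Z , z)} Z≅P₀ →
    reconstruct-forward Q a₀ Z (RelIso-trans {S = rel P₀} {U = extendRel Q} Z≅P₀ θ-iso)
      (Presentation.sp (present Z z))
    where
    t k : ℕ
    t = toℕ rest
    k = n ∸ t
    a₀ : Fin k
    a₀ = fromℕ< (m<n⇒0<n∸m (toℕ<n rest))
    θ : Fin n ↔ (Fin k ⊎ Fin t)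
    θ = subst (λ m → Fin m ↔ (Fin k ⊎ Fin t)) (m∸n+n≡m (<⇒≤ (toℕ<n rest))) +↔⊎
    P₀ : BipPoset n
    P₀ = reconstruct Q θ
    θ-iso : RelIso (rel P₀) (extendRel Q {k})
    θ-iso = θ , λ _ _ → refl
    P₀-unbalanced : Unbalanced P₀
    P₀-unbalanced = from θ (inj₁ a₀) ,
      Invariance.fullSupport-preserved (extendRel Q) (rel P₀) (RelIso-sym {R = rel P₀} θ-iso)
        (support⇒fullSupport Q a₀ (inj₁ a₀) tt)

theorem4p4 : (n : ℕ) → 1 ≤ n → Bijection (UnbalancedSetoid n) (SmallerSetoid n)
theorem4p4 n _ = record
  { to        = forwardClass n
  ; cong      = λ {A} {B} → forward-cong n {A} {B}
  ; bijective = (λ {A} {B} → forward-injective n {A} {B}) , forward-surjective n }
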